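{- Let $L$ be a normalized lattice and $p$ a prime such that $Q(L_p)\neq 2\mathbb{Z}_p$. Then $\Lambda_{2p}(L_p)=\{x\in L_p: Q(x)\in 2p\mathbb{Z}_p\}$.
   Context: A lattice means a positive definite integral $\mathbb{Z}$-lattice on a quadratic space over $\mathbb{Q}$, with quadratic map $Q$; $L_p=L\otimes\mathbb{Z}_p$. The norm $\mathfrak{n}(L)$ is the ideal generated by $Q(L)$, and $L$ is normalized if $\mathfrak{n}(L)=2\mathbb{Z}$. $Q(L_p)$ denotes the set $\{Q(x):x\in L_p\}$. For a positive integer $m$, $\Lambda_m(L_p)=\{x\in L_p: Q(x+z)\equiv Q(z)\pmod{m\mathbb{Z}_p}\text{ for all }z\in L_p\}$. -}

module Defs where

open import Data.Nat as ℕ using (ℕ; zero; suc)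
open import Data.Integer using (ℤ; +_; _+_; _-_; _*_; _<_)
open import Data.Integer.Divisibility using (_∣_)
open import Data.Fin as F using (Fin)
open import Data.Product using (Σ; ∃; _×_; _,_)
open import Data.List using (List; []; _∷_)
open import Relation.Binary.PropositionalEquality using (_≡_; _≢_)
open import Function.Bundles using (_⇔_)

sumFin : (n : ℕ) → (Fin n → ℤ) → ℤ
sumFin zero    f = + 0
sumFin (suc n) f = f F.zero + sumFin n (λ i → f (F.suc i))

-- A Z-lattice of rank n given by its Gram matrix G i j = B(e_i, e_j)
-- with respect to a Z-basis e_1..e_n; Q(x) = B(x,x).

Gram : ℕ → Set
Gram n = Fin n → Fin n → ℤ

Qℤ : {n : ℕ} → Gram n → (Fin n → ℤ) → ℤ
Qℤ {n} G x = sumFin n (λ i → sumFin n (λ j → G i j * (x i * x j)))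

Symmetric : {n : ℕ} → Gram n → Set
Symmetric G = ∀ i j → G i j ≡ G j i

PositiveDefinite : {n : ℕ} → Gram n → Set
PositiveDefinite {n} G = ∀ (x : Fin n → ℤ) → (∃ λ i → x i ≢ + 0) → + 0 < Qℤ G x

-- a is in the ideal of Z generated by Q(L): a = Σ c_k Q(x_k) (finite sum)
data InNormIdeal {n : ℕ} (G : Gram n) : ℤ → Set where
  zero-in : InNormIdeal G (+ 0)
  step    : ∀ {a} (c : ℤ) (x : Fin n → ℤ) → InNormIdeal G a →
            InNormIdeal G (c * Qℤ G x + a)

Normalized : {n : ℕ} → Gram n → Set
Normalized G = ∀ a → (InNormIdeal G a ⇔ (+ 2 ∣ a))

-- p-adic integers Z_p, as coherent approximation sequences
-- (a_k)_k with a_m ≡ a_k (mod p^k) for k ≤ m, up to the equivalence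
-- a ≈ b  iff  a_k ≡ b_k (mod p^k) for all k.

Seq : Set
Seq = ℕ → ℤ

Coherent : ℕ → Seq → Set
Coherent p a = ∀ k m → k ℕ.≤ m → + (p ℕ.^ k) ∣ (a m - a k)

ℤₚ : ℕ → Set
ℤₚ p = Σ Seq (Coherent p)

seq : {p : ℕ} → ℤₚ p → Seq
seq (a , _) = a

_≈[_]_ : Seq → ℕ → Seq → Set
a ≈[ p ] b = ∀ k → + (p ℕ.^ k) ∣ (a k - b k)

_⊕_ : Seq → Seq → Seq
(a ⊕ b) k = a k + b k

_⊖_ : Seq → Seq → Seq
(a ⊖ b) k = a k - b k

_⊙_ : ℤ → Seq → Seq
(c ⊙ a) k = c * a k

-- L_p = L ⊗ Z_p = Z_p^n
Lₚ : ℕ → ℕ → Set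
Lₚ p n = Fin n → ℤₚ p

vseq : {p n : ℕ} → Lₚ p n → Fin n → Seq
vseq x i = seq (x i)

Qₚ : {n : ℕ} → Gram n → (Fin n → Seq) → Seq
Qₚ G x k = Qℤ G (λ i → x i k)

_∈_ℤₚ[_] : Seq → ℤ → ℕ → Set
a ∈ m ℤₚ[ p ] = Σ (ℤₚ p) λ w → a ≈[ p ] (m ⊙ seq w)

InQLₚ : {n : ℕ} → (p : ℕ) → Gram n → Seq → Set
InQLₚ {n} p G a = Σ (Lₚ p n) λ x → Qₚ G (vseq x) ≈[ p ] a

QLₚ≡2ℤₚ : {n : ℕ} → (p : ℕ) → Gram n → Set
QLₚ≡2ℤₚ p G = ∀ (a : ℤₚ p) → (InQLₚ p G (seq a) ⇔ (seq a ∈ + 2 ℤₚ[ p ]))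

InΛ : {n : ℕ} → (p : ℕ) → Gram n → ℕ → Lₚ p n → Set
InΛ {n} p G m x = ∀ (z : Lₚ p n) →
  (Qₚ G (λ i → vseq x i ⊕ vseq z i) ⊖ Qₚ G (vseq z)) ∈ (+ m) ℤₚ[ p ]

-- Since Q(x + z) − Q(z) = Q(x) + 2B(x,z), taking z = 0 gives Λ_{2p}(L_p) ⊆ {x : Q(x) ∈ 2pℤ_p}.
-- Conversely let Q(x) ∈ 2pℤ_p. For z with p ∣ B(x,z) the difference lies in 2pℤ_p. If instead
-- B(x,z) is a p-adic unit, then for every a = 2w ∈ 2ℤ_p Hensel's lemma solves
--   (Q(x)/2) α² + B(x,z) α + (Q(z)/2 − w) = 0
-- (p divides the leading coefficient and the linear one is a unit), so Q(αx + z) = a. Together with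
-- Q(L_p) ⊆ 2ℤ_p, which holds because L is normalized, this gives Q(L_p) = 2ℤ_p, which is excluded.
module Submission where

open import Defs
open import Data.Nat as ℕ using (ℕ; zero; suc; s≤s; z≤n)
import Data.Nat.Properties as ℕₚ
import Data.Nat.Divisibility as ℕD
open import Data.Nat.Coprimality using (Coprime; coprime-Bézout)
open import Data.Nat.GCD using (module Bézout)
open import Data.Nat.Primality
  using (Prime; euclidsLemma; prime⇒nonZero; prime⇒nonTrivial; prime⇒irreducible; prime[2])
open import Data.Integer using (ℤ; +_; -[1+_]; _+_; _-_; _*_; -_)
import Data.Integer.Properties as ℤₚ
open import Data.Integer.Divisibility.Signed
open import Data.Integer.Tactic.RingSolver using (solve-∀)
open import Data.Fin using (Fin)
open import Data.Product using (Σ; _,_; proj₁; proj₂)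
open import Data.Sum using (inj₁; inj₂)
open import Function.Bundles using (_⇔_; mk⇔; Equivalence)
open import Level using (0ℓ)
open import Relation.Nullary using (¬_; yes; no; contradiction)
open import Relation.Binary.Bundles using (Setoid)
open import Relation.Binary.PropositionalEquality
import Relation.Binary.Reasoning.Setoid as ≈-Reasoning

open import Algebra.Properties.Semiring.Sum ℤₚ.+-*-semiring
  using (sum; ∑-comm; ∑-distrib-+; *-distribˡ-sum; sum-cong-≗; sum-replicate-zero)

sumFin≡sum : ∀ n (f : Fin n → ℤ) → sumFin n f ≡ sum f
sumFin≡sum zero    f = refl
sumFin≡sum (suc n) f = cong (λ t → f Fin.zero + t) (sumFin≡sum n _)

sumFin-cong : ∀ n {f g : Fin n → ℤ} → (∀ i → f i ≡ g i) → sumFin n f ≡ sumFin n g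
sumFin-cong n {f} {g} f≗g = begin
  sumFin n f ≡⟨ sumFin≡sum n f ⟩
  sum f      ≡⟨ sum-cong-≗ f≗g ⟩
  sum g      ≡⟨ sumFin≡sum n g ⟨
  sumFin n g ∎
  where open ≡-Reasoning

sumFin-zero : ∀ n {f : Fin n → ℤ} → (∀ i → f i ≡ + 0) → sumFin n f ≡ + 0
sumFin-zero n f≗0 = trans (sumFin-cong n f≗0) (trans (sumFin≡sum n _) (sum-replicate-zero n))

sumFin-linear : ∀ n α (f g : Fin n → ℤ) →
  sumFin n (λ i → α * f i + g i) ≡ α * sumFin n f + sumFin n g
sumFin-linear n α f g = begin
  sumFin n (λ i → α * f i + g i)  ≡⟨ sumFin≡sum n _ ⟩
  sum (λ i → α * f i + g i)       ≡⟨ ∑-distrib-+ (λ i → α * f i) g ⟩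
  sum (λ i → α * f i) + sum g     ≡⟨ cong (_+ sum g) (*-distribˡ-sum α f) ⟨
  α * sum f + sum g               ≡⟨ cong₂ (λ s t → α * s + t) (sumFin≡sum n f) (sumFin≡sum n g) ⟨
  α * sumFin n f + sumFin n g     ∎
  where open ≡-Reasoning

sumFin-comm : ∀ n (f : Fin n → Fin n → ℤ) →
  sumFin n (λ i → sumFin n (f i)) ≡ sumFin n (λ j → sumFin n (λ i → f i j))
sumFin-comm n f = begin
  sumFin n (λ i → sumFin n (f i))          ≡⟨ sumFin-cong n (λ i → sumFin≡sum n (f i)) ⟩
  sumFin n (λ i → sum (f i))               ≡⟨ sumFin≡sum n _ ⟩
  sum (λ i → sum (f i))                    ≡⟨ ∑-comm f ⟩
  sum (λ j → sum (λ i → f i j))            ≡⟨ sumFin≡sum n _ ⟨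
  sumFin n (λ j → sum (λ i → f i j))       ≡⟨ sumFin-cong n (λ j → sumFin≡sum n _) ⟨
  sumFin n (λ j → sumFin n (λ i → f i j))  ∎
  where open ≡-Reasoning

-- A record rather than a synonym for d ∣ a - b, so that a, b and d can be inferred.
infix 4 _≡_mod_
record _≡_mod_ (a b d : ℤ) : Set where
  constructor mod-intro
  field ∣-diff : d ∣ a - b
open _≡_mod_ public

≡mod-reflexive : ∀ {a b d} → a ≡ b → a ≡ b mod d
≡mod-reflexive {a} refl = mod-intro (subst (_ ∣_) (sym (ℤₚ.+-inverseʳ a)) (divides (+ 0) refl))

≡mod-refl : ∀ {a d} → a ≡ a mod d
≡mod-refl = ≡mod-reflexive refl

≡mod-sym : ∀ {a b d} → a ≡ b mod d → b ≡ a mod d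
≡mod-sym {a} {b} (mod-intro d∣a-b) = mod-intro (subst (_ ∣_) (negate a b) (∣m⇒∣-m d∣a-b))
  where
  negate : ∀ a b → - (a - b) ≡ b - a
  negate = solve-∀

≡mod-trans : ∀ {a b c d} → a ≡ b mod d → b ≡ c mod d → a ≡ c mod d
≡mod-trans {a} {b} {c} (mod-intro d∣a-b) (mod-intro d∣b-c) =
  mod-intro (subst (_ ∣_) (telescope a b c) (∣m∣n⇒∣m+n d∣a-b d∣b-c))
  where
  telescope : ∀ a b c → (a - b) + (b - c) ≡ a - c
  telescope = solve-∀

≡mod-weaken : ∀ {a b d e} → d ∣ e → a ≡ b mod e → a ≡ b mod d
≡mod-weaken d∣e (mod-intro e∣a-b) = mod-intro (∣-trans d∣e e∣a-b)

+-≡mod : ∀ {a a′ b b′ d} → a ≡ a′ mod d → b ≡ b′ mod d → a + b ≡ a′ + b′ mod d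
+-≡mod {a} {a′} {b} {b′} (mod-intro da) (mod-intro db) =
  mod-intro (subst (_ ∣_) (regroup a a′ b b′) (∣m∣n⇒∣m+n da db))
  where
  regroup : ∀ a a′ b b′ → (a - a′) + (b - b′) ≡ (a + b) - (a′ + b′)
  regroup = solve-∀

-‿≡mod : ∀ {a a′ b b′ d} → a ≡ a′ mod d → b ≡ b′ mod d → a - b ≡ a′ - b′ mod d
-‿≡mod {a} {a′} {b} {b′} (mod-intro da) (mod-intro db) =
  mod-intro (subst (_ ∣_) (regroup a a′ b b′) (∣m∣n⇒∣m-n da db))
  where
  regroup : ∀ a a′ b b′ → (a - a′) - (b - b′) ≡ (a - b) - (a′ - b′)
  regroup = solve-∀

*-≡mod : ∀ {a a′ b b′ d} → a ≡ a′ mod d → b ≡ b′ mod d → a * b ≡ a′ * b′ mod d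
*-≡mod {a} {a′} {b} {b′} (mod-intro da) (mod-intro db) =
  mod-intro (subst (_ ∣_) (regroup a a′ b b′) (∣m∣n⇒∣m+n (∣m⇒∣m*n b da) (∣n⇒∣m*n a′ db)))
  where
  regroup : ∀ a a′ b b′ → (a - a′) * b + a′ * (b - b′) ≡ a * b - a′ * b′
  regroup = solve-∀

≡mod⇒∣ : ∀ {a b d} → a ≡ b mod d → d ∣ b → d ∣ a
≡mod⇒∣ {a} {b} (mod-intro d∣a-b) d∣b = subst (_ ∣_) (cancel a b) (∣m∣n⇒∣m+n d∣a-b d∣b)
  where
  cancel : ∀ a b → (a - b) + b ≡ a
  cancel = solve-∀

∣⇒≡mod-0 : ∀ {a d} → d ∣ a → a ≡ + 0 mod d
∣⇒≡mod-0 {a} d∣a = mod-intro (subst (_ ∣_) (sym (ℤₚ.+-identityʳ a)) d∣a)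

sumFin-≡mod : ∀ n {d} {f g : Fin n → ℤ} → (∀ i → f i ≡ g i mod d) → sumFin n f ≡ sumFin n g mod d
sumFin-≡mod zero    _   = ≡mod-refl
sumFin-≡mod (suc n) f≡g = +-≡mod (f≡g Fin.zero) (sumFin-≡mod n (λ i → f≡g (Fin.suc i)))

Bℤ : ∀ {n} → Gram n → (Fin n → ℤ) → (Fin n → ℤ) → ℤ
Bℤ {n} G u v = sumFin n (λ i → sumFin n (λ j → G i j * (u i * v j)))

Bℤ-sym : ∀ {n} (G : Gram n) → Symmetric G → ∀ u v → Bℤ G u v ≡ Bℤ G v u
Bℤ-sym {n} G G-sym u v = trans
  (sumFin-comm n (λ i j → G i j * (u i * v j)))
  (sumFin-cong n λ j → sumFin-cong n λ i → cong₂ _*_ (G-sym i j) (ℤₚ.*-comm (u i) (v j)))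

Bℤ-linearˡ : ∀ {n} (G : Gram n) α u v w →
  Bℤ G (λ i → α * u i + v i) w ≡ α * Bℤ G u w + Bℤ G v w
Bℤ-linearˡ {n} G α u v w = trans
  (sumFin-cong n λ i → trans
    (sumFin-cong n λ j → distrib (G i j) α (u i) (v i) (w j))
    (sumFin-linear n α _ _))
  (sumFin-linear n α _ _)
  where
  distrib : ∀ g α a b c → g * ((α * a + b) * c) ≡ α * (g * (a * c)) + g * (b * c)
  distrib = solve-∀

Bℤ-≡mod : ∀ {n} (G : Gram n) {d} {u u′ v v′ : Fin n → ℤ} →
  (∀ i → u i ≡ u′ i mod d) → (∀ i → v i ≡ v′ i mod d) → Bℤ G u v ≡ Bℤ G u′ v′ mod d
Bℤ-≡mod {n} G u≡u′ v≡v′ = sumFin-≡mod n λ i → sumFin-≡mod n λ j →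
  *-≡mod (≡mod-refl {G i j}) (*-≡mod (u≡u′ i) (v≡v′ j))

Qℤ-cong : ∀ {n} (G : Gram n) {u v : Fin n → ℤ} → (∀ i → u i ≡ v i) → Qℤ G u ≡ Qℤ G v
Qℤ-cong {n} G u≗v =
  sumFin-cong n λ i → sumFin-cong n λ j → cong (G i j *_) (cong₂ _*_ (u≗v i) (u≗v j))

Qℤ-zero : ∀ {n} (G : Gram n) → Qℤ G (λ _ → + 0) ≡ + 0
Qℤ-zero {n} G = sumFin-zero n λ i → sumFin-zero n λ j → ℤₚ.*-zeroʳ (G i j)

Qℤ-expand : ∀ {n} (G : Gram n) → Symmetric G → ∀ α u v →
  Qℤ G (λ i → α * u i + v i) ≡ α * α * Qℤ G u + + 2 * α * Bℤ G u v + Qℤ G v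
Qℤ-expand {n} G G-sym α u v = begin
  Bℤ G αu+v αu+v
    ≡⟨ Bℤ-linearˡ G α u v αu+v ⟩
  α * Bℤ G u αu+v + Bℤ G v αu+v
    ≡⟨ cong₂ (λ s t → α * s + t) (linearʳ u) (linearʳ v) ⟩
  α * (α * Bℤ G u u + Bℤ G u v) + (α * Bℤ G v u + Bℤ G v v)
    ≡⟨ cong (λ t → α * (α * Bℤ G u u + Bℤ G u v) + (α * t + Bℤ G v v)) (Bℤ-sym G G-sym v u) ⟩
  α * (α * Bℤ G u u + Bℤ G u v) + (α * Bℤ G u v + Bℤ G v v)
    ≡⟨ collect α (Bℤ G u u) (Bℤ G u v) (Bℤ G v v) ⟩
  α * α * Bℤ G u u + + 2 * α * Bℤ G u v + Bℤ G v v
    ∎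
  where
  open ≡-Reasoning
  αu+v : Fin n → ℤ
  αu+v i = α * u i + v i
  linearʳ : ∀ w → Bℤ G w αu+v ≡ α * Bℤ G w u + Bℤ G w v
  linearʳ w = trans (Bℤ-sym G G-sym w αu+v) (trans (Bℤ-linearˡ G α u v w)
                (cong₂ (λ s t → α * s + t) (Bℤ-sym G G-sym u w) (Bℤ-sym G G-sym v w)))
  collect : ∀ α a b c → α * (α * a + b) + (α * b + c) ≡ α * α * a + + 2 * α * b + c
  collect = solve-∀

Qℤ-+ : ∀ {n} (G : Gram n) → Symmetric G → ∀ u v →
  Qℤ G (λ i → u i + v i) ≡ Qℤ G u + + 2 * Bℤ G u v + Qℤ G v
Qℤ-+ G G-sym u v = begin
  Qℤ G (λ i → u i + v i)
    ≡⟨ Qℤ-cong G (λ i → cong (_+ v i) (ℤₚ.*-identityˡ (u i))) ⟨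
  Qℤ G (λ i → + 1 * u i + v i)
    ≡⟨ Qℤ-expand G G-sym (+ 1) u v ⟩
  + 1 * + 1 * Qℤ G u + + 2 * + 1 * Bℤ G u v + Qℤ G v
    ≡⟨ unit (Qℤ G u) (Bℤ G u v) (Qℤ G v) ⟩
  Qℤ G u + + 2 * Bℤ G u v + Qℤ G v
    ∎
  where
  open ≡-Reasoning
  unit : ∀ a b c → + 1 * + 1 * a + + 2 * + 1 * b + c ≡ a + + 2 * b + c
  unit = solve-∀

quadratic : ℤ → ℤ → ℤ → ℤ → ℤ
quadratic q b r α = q * (α * α) + b * α + r

quadratic-≡mod : ∀ {q q′ b b′ r r′ α α′ d} →
  q ≡ q′ mod d → b ≡ b′ mod d → r ≡ r′ mod d → α ≡ α′ mod d →
  quadratic q b r α ≡ quadratic q′ b′ r′ α′ mod d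
quadratic-≡mod q≡ b≡ r≡ α≡ = +-≡mod (+-≡mod (*-≡mod q≡ (*-≡mod α≡ α≡)) (*-≡mod b≡ α≡)) r≡

-- solve-∀ does not unfold quadratic, so these identities are proved in unfolded form.
quadratic-newton : ∀ q b r α u →
  quadratic q b r (α - u * quadratic q b r α) ≡
  quadratic q b r α * ((+ 1 - u * b) - q * (+ 2 * α * u - u * u * quadratic q b r α))
quadratic-newton = identity
  where
  identity : ∀ q b r α u →
    q * ((α - u * (q * (α * α) + b * α + r)) * (α - u * (q * (α * α) + b * α + r)))
      + b * (α - u * (q * (α * α) + b * α + r)) + r ≡
    (q * (α * α) + b * α + r) * ((+ 1 - u * b) - q * (+ 2 * α * u - u * u * (q * (α * α) + b * α + r)))
  identity = solve-∀

quadratic-difference : ∀ q b r α β →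
  quadratic q b r α - quadratic q b r β ≡ (α - β) * (q * (α + β) + b)
quadratic-difference = identity
  where
  identity : ∀ q b r α β →
    (q * (α * α) + b * α + r) - (q * (β * β) + b * β + r) ≡ (α - β) * (q * (α + β) + b)
  identity = solve-∀

quadratic-doubled : ∀ α q b c w →
  α * α * (+ 2 * q) + + 2 * α * b + + 2 * c ≡ + 2 * (quadratic q b (c - w) α + w)
quadratic-doubled = identity
  where
  identity : ∀ α q b c w →
    α * α * (+ 2 * q) + + 2 * α * b + + 2 * c ≡ + 2 * ((q * (α * α) + b * α + (c - w)) + w)
  identity = solve-∀

^-∣-cancel-coprime : ∀ {p u} → Prime p → ¬ p ℕD.∣ u → ∀ k {m} →
  p ℕ.^ k ℕD.∣ m ℕ.* u → p ℕ.^ k ℕD.∣ m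
^-∣-cancel-coprime _ _ zero {m} _ = ℕD.1∣ m
^-∣-cancel-coprime {p} {u} p-prime p∤u (suc k) {m} pᵏ⁺¹∣mu
  with euclidsLemma m u p-prime (ℕD.∣-trans (ℕD.m∣m*n (p ℕ.^ k)) pᵏ⁺¹∣mu)
... | inj₂ p∣u = contradiction p∣u p∤u
... | inj₁ (ℕD.divides m′ refl) = subst (p ℕ.^ suc k ℕD.∣_) (ℕₚ.*-comm p m′)
        (ℕD.*-monoʳ-∣ p (^-∣-cancel-coprime p-prime p∤u k (ℕD.*-cancelˡ-∣ p ppᵏ∣pm′u)))
  where
  instance _ = prime⇒nonZero p-prime
  ppᵏ∣pm′u : p ℕ.* p ℕ.^ k ℕD.∣ p ℕ.* (m′ ℕ.* u)
  ppᵏ∣pm′u = subst (p ℕ.* p ℕ.^ k ℕD.∣_)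
    (trans (cong (ℕ._* u) (ℕₚ.*-comm m′ p)) (ℕₚ.*-assoc p m′ u)) pᵏ⁺¹∣mu

module Padic (p : ℕ) where

  p^_ : ℕ → ℤ
  p^ k = + (p ℕ.^ k)

  p^-suc : ∀ k → p^ suc k ≡ + p * p^ k
  p^-suc k = ℤₚ.pos-* p (p ℕ.^ k)

  p^-mono-∣ : ∀ {k m} → k ℕ.≤ m → p^ k ∣ p^ m
  p^-mono-∣ {k} k≤m with ℕₚ.m≤n⇒∃[o]m+o≡n k≤m
  ... | o , refl = ∣ᵤ⇒∣ (ℕD.divides (p ℕ.^ o)
        (trans (ℕₚ.^-distribˡ-+-* p k o) (ℕₚ.*-comm (p ℕ.^ k) (p ℕ.^ o))))

  ≡mod-p^-weaken : ∀ {a b k m} → k ℕ.≤ m → a ≡ b mod p^ m → a ≡ b mod p^ k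
  ≡mod-p^-weaken k≤m = ≡mod-weaken (p^-mono-∣ k≤m)

  ≡mod-p^1⇒≡mod-p : ∀ {a b} → a ≡ b mod p^ 1 → a ≡ b mod + p
  ≡mod-p^1⇒≡mod-p {a} {b} = subst (λ t → a ≡ b mod + t) (ℕₚ.*-identityʳ p)

  -- The relation _≈[ p ]_ of Defs, as a record for the same reason as _≡_mod_.
  infix 4 _≋_
  record _≋_ (a b : Seq) : Set where
    constructor ≋-intro
    field ≡mod-at : ∀ k → a k ≡ b k mod p^ k
  open _≋_ public

  ≈⇒≋ : ∀ {a b} → a ≈[ p ] b → a ≋ b
  ≈⇒≋ a≈b = ≋-intro λ k → mod-intro (∣ᵤ⇒∣ (a≈b k))

  ≋⇒≈ : ∀ {a b} → a ≋ b → a ≈[ p ] b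
  ≋⇒≈ a≋b k = ∣⇒∣ᵤ (∣-diff (≡mod-at a≋b k))

  ≋-refl : ∀ {a} → a ≋ a
  ≋-refl = ≋-intro λ _ → ≡mod-refl

  ≋-sym : ∀ {a b} → a ≋ b → b ≋ a
  ≋-sym a≋b = ≋-intro λ k → ≡mod-sym (≡mod-at a≋b k)

  ≋-trans : ∀ {a b c} → a ≋ b → b ≋ c → a ≋ c
  ≋-trans a≋b b≋c = ≋-intro λ k → ≡mod-trans (≡mod-at a≋b k) (≡mod-at b≋c k)

  ≋-setoid : Setoid 0ℓ 0ℓ
  ≋-setoid = record
    { Carrier       = Seq
    ; _≈_           = _≋_
    ; isEquivalence = record { refl = ≋-refl ; sym = ≋-sym ; trans = ≋-trans }
    }

  ≋-pointwise : ∀ {a b} → (∀ k → a k ≡ b k) → a ≋ b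
  ≋-pointwise a≗b = ≋-intro λ k → ≡mod-reflexive (a≗b k)

  coherent : (a : ℤₚ p) → ∀ {k m} → k ℕ.≤ m → seq a m ≡ seq a k mod p^ k
  coherent (a , a-coh) {k} {m} k≤m = mod-intro (∣ᵤ⇒∣ (a-coh k m k≤m))

  mkℤₚ : (a : Seq) → (∀ {k m} → k ℕ.≤ m → a m ≡ a k mod p^ k) → ℤₚ p
  mkℤₚ a a-coh = a , λ k m k≤m → ∣⇒∣ᵤ (∣-diff (a-coh k≤m))

  residue-constant : (a : ℤₚ p) → ∀ k → seq a (suc k) ≡ seq a 1 mod + p
  residue-constant a k = ≡mod-p^1⇒≡mod-p (coherent a (s≤s z≤n))

  _⊗_ : Seq → Seq → Seq
  (a ⊗ b) k = a k * b k

  zipWith-≋ : ∀ (_∙_ : ℤ → ℤ → ℤ) →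
    (∀ {a a′ b b′ d} → a ≡ a′ mod d → b ≡ b′ mod d → a ∙ b ≡ a′ ∙ b′ mod d) →
    ∀ {a a′ b b′} → a ≋ a′ → b ≋ b′ → (λ k → a k ∙ b k) ≋ (λ k → a′ k ∙ b′ k)
  zipWith-≋ _ ∙-cong a≋a′ b≋b′ = ≋-intro λ k → ∙-cong (≡mod-at a≋a′ k) (≡mod-at b≋b′ k)

  zipWith-ℤₚ : ∀ (_∙_ : ℤ → ℤ → ℤ) →
    (∀ {a a′ b b′ d} → a ≡ a′ mod d → b ≡ b′ mod d → a ∙ b ≡ a′ ∙ b′ mod d) →
    ℤₚ p → ℤₚ p → ℤₚ p
  zipWith-ℤₚ _∙_ ∙-cong a b =
    mkℤₚ (λ k → seq a k ∙ seq b k) λ k≤m → ∙-cong (coherent a k≤m) (coherent b k≤m)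

  ⊕-cong : ∀ {a a′ b b′} → a ≋ a′ → b ≋ b′ → a ⊕ b ≋ a′ ⊕ b′
  ⊕-cong = zipWith-≋ _+_ +-≡mod

  ⊗-cong : ∀ {a a′ b b′} → a ≋ a′ → b ≋ b′ → a ⊗ b ≋ a′ ⊗ b′
  ⊗-cong = zipWith-≋ _*_ *-≡mod

  ⊙-congˡ : ∀ c {a a′} → a ≋ a′ → c ⊙ a ≋ c ⊙ a′
  ⊙-congˡ c a≋a′ = ≋-intro λ k → *-≡mod (≡mod-refl {c}) (≡mod-at a≋a′ k)

  _+ₚ_ _-ₚ_ _*ₚ_ : ℤₚ p → ℤₚ p → ℤₚ p
  _+ₚ_ = zipWith-ℤₚ _+_ +-≡mod
  _-ₚ_ = zipWith-ℤₚ _-_ -‿≡mod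
  _*ₚ_ = zipWith-ℤₚ _*_ *-≡mod

  ∈pℤₚ⇒p∣₁ : ∀ (a : Seq) → a ∈ + p ℤₚ[ p ] → + p ∣ a 1
  ∈pℤₚ⇒p∣₁ a (w , a≈pw) =
    ≡mod⇒∣ (≡mod-p^1⇒≡mod-p (≡mod-at (≈⇒≋ {a} {(+ p) ⊙ seq w} a≈pw) 1))
           (∣m⇒∣m*n (seq w 1) (∣-refl {+ p}))

  -- i.e. v_p(c) ≤ 1; this holds for c = p and, p being prime, for c = 2.
  OneLevelCancellable : ℤ → Set
  OneLevelCancellable c = ∀ k {h} → p^ suc k ∣ c * h → p^ k ∣ h

  ∈ℤₚ-divide : ∀ {c} → OneLevelCancellable c → (a : ℤₚ p) → (∀ k → c ∣ seq a (suc k)) →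
    seq a ∈ c ℤₚ[ p ]
  ∈ℤₚ-divide {c} cancel a c∣a = w , ≋⇒≈ {seq a} {c ⊙ seq w} (≋-intro λ k →
    ≡mod-trans (≡mod-sym (coherent a (ℕₚ.n≤1+n k))) (≡mod-reflexive (a≡ch k)))
    where
    h : Seq
    h k = quotient (c∣a k)
    a≡ch : ∀ k → seq a (suc k) ≡ c * h k
    a≡ch k = trans (_∣_.equality (c∣a k)) (ℤₚ.*-comm (h k) c)
    factor : ∀ c h h′ → c * h - c * h′ ≡ c * (h - h′)
    factor = solve-∀
    w : ℤₚ p
    w = mkℤₚ h λ {k} {m} k≤m → mod-intro (cancel k (subst (_ ∣_)
          (trans (cong₂ _-_ (a≡ch m) (a≡ch k)) (factor c (h m) (h k)))
          (∣-diff (coherent a (s≤s k≤m)))))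

  ∈ℤₚ-cancel : ∀ {c m} → OneLevelCancellable c → (a : ℤₚ p) →
    (c ⊙ seq a) ∈ (c * m) ℤₚ[ p ] → seq a ∈ m ℤₚ[ p ]
  ∈ℤₚ-cancel {c} {m} cancel a (w , ca≈cmw) = w , ≋⇒≈ {seq a} {m ⊙ seq w} (≋-intro λ k →
    ≡mod-trans (≡mod-sym (coherent a (ℕₚ.n≤1+n k)))
      (≡mod-trans (a≡mw-one-level-up k) (*-≡mod (≡mod-refl {m}) (coherent w (ℕₚ.n≤1+n k)))))
    where
    factor : ∀ c m a w → c * a - c * m * w ≡ c * (a - m * w)
    factor = solve-∀
    a≡mw-one-level-up : ∀ k → seq a (suc k) ≡ m * seq w (suc k) mod p^ k
    a≡mw-one-level-up k = mod-intro (cancel k (subst (_ ∣_) (factor c m (seq a (suc k)) (seq w (suc k)))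
      (∣-diff (≡mod-at (≈⇒≋ {c ⊙ seq a} {(c * m) ⊙ seq w} ca≈cmw) (suc k)))))

module PrimePadic {p : ℕ} (p-prime : Prime p) where

  open Padic p

  instance
    p≢0 : ℕ.NonZero p
    p≢0 = prime⇒nonZero p-prime

  p^-∣-cancel-unit : ∀ {u v} k → ¬ + p ∣ u → p^ k ∣ v * u → p^ k ∣ v
  p^-∣-cancel-unit {u} {v} k p∤u pᵏ∣vu = ∣ᵤ⇒∣
    (^-∣-cancel-coprime p-prime (λ p∣u → p∤u (∣ᵤ⇒∣ p∣u)) k
      (subst (p ℕ.^ k ℕD.∣_) (ℤₚ.abs-* v u) (∣⇒∣ᵤ pᵏ∣vu)))

  p-cancellable : OneLevelCancellable (+ p)
  p-cancellable k pᵏ⁺¹∣ph = *-cancelˡ-∣ (+ p) (subst (_∣ _) (p^-suc k) pᵏ⁺¹∣ph)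

  2-cancellable : OneLevelCancellable (+ 2)
  2-cancellable k {h} pᵏ⁺¹∣2h with p ℕ.≟ 2
  ... | yes refl = p-cancellable k pᵏ⁺¹∣2h
  ... | no  p≢2  = ∣-trans (p^-mono-∣ (ℕₚ.n≤1+n k))
                     (p^-∣-cancel-unit (suc k) p∤2 (subst (_ ∣_) (ℤₚ.*-comm (+ 2) h) pᵏ⁺¹∣2h))
    where
    p∤2 : ¬ + p ∣ + 2
    p∤2 p∣2 with prime⇒irreducible prime[2] (∣⇒∣ᵤ p∣2)
    ... | inj₁ p≡1 = ℕ.nonTrivial⇒≢1 ⦃ prime⇒nonTrivial p-prime ⦄ p≡1
    ... | inj₂ p≡2 = p≢2 p≡2

  ∤⇒coprime : ∀ {m} → ¬ p ℕD.∣ m → Coprime p m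
  ∤⇒coprime p∤m (d∣p , d∣m) with prime⇒irreducible p-prime d∣p
  ... | inj₁ d≡1  = d≡1
  ... | inj₂ refl = contradiction d∣m p∤m

  Bézout⇒inverse : ∀ {m} → Bézout.Identity 1 p m → Σ ℤ λ u → u * + m ≡ + 1 mod + p
  Bézout⇒inverse {m} (Bézout.+- x y 1+ym≡xp) = - + y , mod-intro (divides (- + x) (begin
    - + y * + m - + 1    ≡⟨ negate (+ y) (+ m) ⟩
    - (+ 1 + + y * + m)  ≡⟨ cong -_ (cast y m x p 1+ym≡xp) ⟩
    - (+ x * + p)        ≡⟨ ℤₚ.neg-distribˡ-* (+ x) (+ p) ⟩
    - + x * + p          ∎))
    where
    open ≡-Reasoning
    negate : ∀ y m → - y * m - + 1 ≡ - (+ 1 + y * m)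
    negate = solve-∀
    cast : ∀ a b c d → 1 ℕ.+ a ℕ.* b ≡ c ℕ.* d → + 1 + + a * + b ≡ + c * + d
    cast a b c d eq = trans (cong (λ t → + 1 + t) (sym (ℤₚ.pos-* a b)))
                            (trans (cong +_ eq) (ℤₚ.pos-* c d))
  Bézout⇒inverse {m} (Bézout.-+ x y 1+xp≡ym) = + y , mod-intro (divides (+ x) (begin
    + y * + m - + 1          ≡⟨ cong (_- + 1) (cast x p y m 1+xp≡ym) ⟨
    (+ 1 + + x * + p) - + 1  ≡⟨ cancel (+ x * + p) ⟩
    + x * + p                ∎))
    where
    open ≡-Reasoning
    cancel : ∀ a → (+ 1 + a) - + 1 ≡ a
    cancel = solve-∀
    cast : ∀ a b c d → 1 ℕ.+ a ℕ.* b ≡ c ℕ.* d → + 1 + + a * + b ≡ + c * + d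
    cast a b c d eq = trans (cong (λ t → + 1 + t) (sym (ℤₚ.pos-* a b)))
                            (trans (cong +_ eq) (ℤₚ.pos-* c d))

  inverse-mod-p : ∀ {b} → ¬ + p ∣ b → Σ ℤ λ u → u * b ≡ + 1 mod + p
  inverse-mod-p {+ m} p∤b = Bézout⇒inverse (coprime-Bézout (∤⇒coprime (λ p∣m → p∤b (∣ᵤ⇒∣ p∣m))))
  inverse-mod-p { -[1+ m ]} p∤b with inverse-mod-p {+ suc m} (λ p∣m → p∤b (∣m⇒∣-m p∣m))
  ... | u , u*m≡1 = - u , subst (λ t → t ≡ + 1 mod + p) (negate u (+ suc m)) u*m≡1
    where
    negate : ∀ u m → u * m ≡ - u * - m
    negate = solve-∀

  -- Newton's step α ↦ α - u f(α), with u inverse to b ≡ f′(α) modulo p.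
  quadratic-root : ∀ {q b} r → + p ∣ q → ¬ + p ∣ b → ∀ k → Σ ℤ λ α → p^ k ∣ quadratic q b r α
  quadratic-root r _ _ zero = + 0 , ∣ᵤ⇒∣ (ℕD.1∣ _)
  quadratic-root {q} {b} r p∣q p∤b (suc k) with quadratic-root r p∣q p∤b k | inverse-mod-p p∤b
  ... | α , pᵏ∣f[α] | u , ub≡1 = α - u * quadratic q b r α ,
    subst (_∣ _) (trans (ℤₚ.*-comm (p^ k) (+ p)) (sym (p^-suc k)))
      (subst (_ ∣_) (sym (quadratic-newton q b r α u))
        (∣-trans (*-monoˡ-∣ (+ p) pᵏ∣f[α]) (*-monoʳ-∣ (quadratic q b r α) p∣correction)))
    where
    p∣correction : + p ∣ (+ 1 - u * b) - q * (+ 2 * α * u - u * u * quadratic q b r α)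
    p∣correction = ∣m∣n⇒∣m-n (∣-diff (≡mod-sym ub≡1)) (∣m⇒∣m*n _ p∣q)

  quadratic-root-unique : ∀ {q b r α β} k → + p ∣ q → ¬ + p ∣ b →
    p^ k ∣ quadratic q b r α → p^ k ∣ quadratic q b r β → α ≡ β mod p^ k
  quadratic-root-unique {q} {b} {r} {α} {β} k p∣q p∤b pᵏ∣f[α] pᵏ∣f[β] = mod-intro
    (p^-∣-cancel-unit k p∤q[α+β]+b
      (subst (_ ∣_) (quadratic-difference q b r α β) (∣m∣n⇒∣m-n pᵏ∣f[α] pᵏ∣f[β])))
    where
    p∤q[α+β]+b : ¬ + p ∣ q * (α + β) + b
    p∤q[α+β]+b p∣d = p∤b (∣m+n∣m⇒∣n p∣d (∣m⇒∣m*n (α + β) p∣q))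

  -- Level k of the root is a root modulo p^k of the coefficients at level k + 1, where p ∣ q and
  -- p ∤ b are known; uniqueness of such roots makes it coherent.
  hensel : (q b r : ℤₚ p) → + p ∣ seq q 1 → ¬ + p ∣ seq b 1 →
    Σ (ℤₚ p) λ α → ∀ k → p^ k ∣ quadratic (seq q k) (seq b k) (seq r k) (seq α k)
  hensel q b r p∣q₁ p∤b₁ = α , λ k → lower ℕₚ.≤-refl (ℕₚ.n≤1+n k) (proj₂ (root k))
    where
    f : ℕ → ℤ → ℤ
    f k = quadratic (seq q k) (seq b k) (seq r k)

    lower : ∀ {j k m α} → j ℕ.≤ k → k ℕ.≤ m → p^ j ∣ f m α → p^ j ∣ f k α
    lower {α = α} j≤k k≤m = ≡mod⇒∣ (≡mod-p^-weaken j≤k (≡mod-sym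
      (quadratic-≡mod (coherent q k≤m) (coherent b k≤m) (coherent r k≤m) (≡mod-refl {α}))))

    p∣q : ∀ k → + p ∣ seq q (suc k)
    p∣q k = ≡mod⇒∣ (residue-constant q k) p∣q₁

    p∤b : ∀ k → ¬ + p ∣ seq b (suc k)
    p∤b k p∣b = p∤b₁ (≡mod⇒∣ (≡mod-sym (residue-constant b k)) p∣b)

    root : ∀ k → Σ ℤ λ α → p^ k ∣ f (suc k) α
    root k = quadratic-root (seq r (suc k)) (p∣q k) (p∤b k) k

    α : ℤₚ p
    α = mkℤₚ (λ k → proj₁ (root k)) λ {k} {m} k≤m → quadratic-root-unique k (p∣q k) (p∤b k)
      (lower (ℕₚ.n≤1+n k) (s≤s k≤m) (∣-trans (p^-mono-∣ k≤m) (proj₂ (root m))))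
      (proj₂ (root k))

module LatticeLevels {n : ℕ} (G : Gram n) (p : ℕ) where

  open Padic p

  _⟨_⟩ : Lₚ p n → ℕ → Fin n → ℤ
  (x ⟨ k ⟩) i = seq (x i) k

  Bₚ : Lₚ p n → Lₚ p n → ℤₚ p
  Bₚ x z = mkℤₚ (λ k → Bℤ G (x ⟨ k ⟩) (z ⟨ k ⟩)) λ k≤m →
    Bℤ-≡mod G (λ i → coherent (x i) k≤m) (λ i → coherent (z i) k≤m)

  0ₗ : Lₚ p n
  0ₗ _ = mkℤₚ (λ _ → + 0) λ _ → ≡mod-refl

  Λ⇒Q∈mℤₚ : ∀ {m} x → InΛ p G m x → Qₚ G (vseq x) ∈ + m ℤₚ[ p ]
  Λ⇒Q∈mℤₚ {m} x x∈Λ with x∈Λ 0ₗ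
  ... | w , Q[x+0]-Q[0]≈mw = w , ≋⇒≈ {Qₚ G (vseq x)} {(+ m) ⊙ seq w} (begin
    Qₚ G (vseq x)                                       ≈⟨ ≋-pointwise Q[x+0]-Q[0]≡Q[x] ⟨
    Qₚ G (λ i → vseq x i ⊕ vseq 0ₗ i) ⊖ Qₚ G (vseq 0ₗ)  ≈⟨ ≈⇒≋ Q[x+0]-Q[0]≈mw ⟩
    (+ m) ⊙ seq w                                       ∎)
    where
    open ≈-Reasoning ≋-setoid
    Q[x+0]-Q[0]≡Q[x] : ∀ k → Qℤ G (λ i → seq (x i) k + + 0) - Qℤ G (λ _ → + 0) ≡ Qℤ G (x ⟨ k ⟩)
    Q[x+0]-Q[0]≡Q[x] k = trans
      (cong₂ _-_ (Qℤ-cong G λ i → ℤₚ.+-identityʳ (seq (x i) k)) (Qℤ-zero G))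
      (ℤₚ.+-identityʳ _)

module NormalizedLattice {n : ℕ} (G : Gram n) (G-sym : Symmetric G) (G-normalized : Normalized G)
                         {p : ℕ} (p-prime : Prime p) where

  open Padic p
  open PrimePadic p-prime
  open LatticeLevels G p

  2p≡2*p : + (2 ℕ.* p) ≡ + 2 * + p
  2p≡2*p = ℤₚ.pos-* 2 p

  Qℤ-even : ∀ u → + 2 ∣ Qℤ G u
  Qℤ-even u = ∣ᵤ⇒∣ (Equivalence.to (G-normalized (Qℤ G u))
    (subst (InNormIdeal G) (unit (Qℤ G u)) (step (+ 1) u zero-in)))
    where
    unit : ∀ a → + 1 * a + + 0 ≡ a
    unit = solve-∀

  Q∈2ℤₚ : (y : Lₚ p n) → Qₚ G (vseq y) ∈ + 2 ℤₚ[ p ]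
  Q∈2ℤₚ y = ∈ℤₚ-divide 2-cancellable (Bₚ y y) (λ k → Qℤ-even (y ⟨ suc k ⟩))

  half : Lₚ p n → ℤₚ p
  half y = proj₁ (Q∈2ℤₚ y)

  Q≋2half : ∀ y → Qₚ G (vseq y) ≋ (+ 2) ⊙ seq (half y)
  Q≋2half y = ≈⇒≋ {Qₚ G (vseq y)} {(+ 2) ⊙ seq (half y)} (proj₂ (Q∈2ℤₚ y))

  QLₚ⊆2ℤₚ : ∀ a → InQLₚ p G a → a ∈ + 2 ℤₚ[ p ]
  QLₚ⊆2ℤₚ a (y , Qy≈a) = half y , ≋⇒≈ {a} {(+ 2) ⊙ seq (half y)}
    (≋-trans (≋-sym (≈⇒≋ {Qₚ G (vseq y)} {a} Qy≈a)) (Q≋2half y))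

  Q∈2pℤₚ⇒p∣half₁ : ∀ x → Qₚ G (vseq x) ∈ + (2 ℕ.* p) ℤₚ[ p ] → + p ∣ seq (half x) 1
  Q∈2pℤₚ⇒p∣half₁ x (w , Qx≈2pw) = ∈pℤₚ⇒p∣₁ (seq (half x))
    (∈ℤₚ-cancel {+ 2} {+ p} 2-cancellable (half x)
      (w , ≋⇒≈ {(+ 2) ⊙ seq (half x)} {(+ 2 * + p) ⊙ seq w} (begin
        (+ 2) ⊙ seq (half x)      ≈⟨ Q≋2half x ⟨
        Qₚ G (vseq x)             ≈⟨ ≈⇒≋ {Qₚ G (vseq x)} {(+ (2 ℕ.* p)) ⊙ seq w} Qx≈2pw ⟩
        (+ (2 ℕ.* p)) ⊙ seq w     ≈⟨ ≋-pointwise (λ k → cong (_* seq w k) 2p≡2*p) ⟩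
        (+ 2 * + p) ⊙ seq w       ∎)))
    where open ≈-Reasoning ≋-setoid

  p∣B⇒Q[x+z]-Q[z]∈2pℤₚ : ∀ x z → Qₚ G (vseq x) ∈ + (2 ℕ.* p) ℤₚ[ p ] → + p ∣ seq (Bₚ x z) 1 →
    (Qₚ G (λ i → vseq x i ⊕ vseq z i) ⊖ Qₚ G (vseq z)) ∈ + (2 ℕ.* p) ℤₚ[ p ]
  p∣B⇒Q[x+z]-Q[z]∈2pℤₚ x z (w , Qx≈2pw) p∣B₁ =
    w +ₚ β , ≋⇒≈ {Q[x+z]-Q[z]} {(+ (2 ℕ.* p)) ⊙ seq (w +ₚ β)} (begin
      Q[x+z]-Q[z]
        ≈⟨ ≋-pointwise expand ⟩
      Qₚ G (vseq x) ⊕ ((+ 2) ⊙ seq (Bₚ x z))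
        ≈⟨ ⊕-cong (≈⇒≋ {Qₚ G (vseq x)} {(+ (2 ℕ.* p)) ⊙ seq w} Qx≈2pw)
                  (⊙-congˡ (+ 2) (≈⇒≋ {seq (Bₚ x z)} {(+ p) ⊙ seq β} B≈pβ)) ⟩
      ((+ (2 ℕ.* p)) ⊙ seq w) ⊕ ((+ 2) ⊙ ((+ p) ⊙ seq β))
        ≈⟨ ≋-pointwise (λ k → collect (seq w k) (seq β k)) ⟩
      (+ (2 ℕ.* p)) ⊙ seq (w +ₚ β)
        ∎)
    where
    open ≈-Reasoning ≋-setoid
    Q[x+z]-Q[z] : Seq
    Q[x+z]-Q[z] = Qₚ G (λ i → vseq x i ⊕ vseq z i) ⊖ Qₚ G (vseq z)
    B∈pℤₚ : seq (Bₚ x z) ∈ + p ℤₚ[ p ]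
    B∈pℤₚ = ∈ℤₚ-divide p-cancellable (Bₚ x z) λ k → ≡mod⇒∣ (residue-constant (Bₚ x z) k) p∣B₁
    β : ℤₚ p
    β = proj₁ B∈pℤₚ
    B≈pβ : seq (Bₚ x z) ≈[ p ] ((+ p) ⊙ seq β)
    B≈pβ = proj₂ B∈pℤₚ
    expand : ∀ k → Q[x+z]-Q[z] k ≡ Qℤ G (x ⟨ k ⟩) + + 2 * Bℤ G (x ⟨ k ⟩) (z ⟨ k ⟩)
    expand k = trans (cong (_- Qℤ G (z ⟨ k ⟩)) (Qℤ-+ G G-sym (x ⟨ k ⟩) (z ⟨ k ⟩)))
                     (cancel (Qℤ G (x ⟨ k ⟩)) (+ 2 * Bℤ G (x ⟨ k ⟩) (z ⟨ k ⟩)) (Qℤ G (z ⟨ k ⟩)))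
      where
      cancel : ∀ a b c → a + b + c - c ≡ a + b
      cancel = solve-∀
    collect : ∀ w β → + (2 ℕ.* p) * w + + 2 * (+ p * β) ≡ + (2 ℕ.* p) * (w + β)
    collect w β = trans (cong (λ t → t * w + + 2 * (+ p * β)) 2p≡2*p)
                 (trans (identity (+ p) w β) (cong (_* (w + β)) (sym 2p≡2*p)))
      where
      identity : ∀ p w β → + 2 * p * w + + 2 * (p * β) ≡ + 2 * p * (w + β)
      identity = solve-∀

  2ℤₚ⊆QLₚ : ∀ x z → Qₚ G (vseq x) ∈ + (2 ℕ.* p) ℤₚ[ p ] → ¬ + p ∣ seq (Bₚ x z) 1 →
    ∀ a → a ∈ + 2 ℤₚ[ p ] → InQLₚ p G a
  2ℤₚ⊆QLₚ x z Qx∈2pℤₚ p∤B₁ a (w , a≈2w) = y , ≋⇒≈ {Qₚ G (vseq y)} {a} (begin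
    Qₚ G (vseq y)
      ≈⟨ ≋-pointwise (λ k → Qℤ-expand G G-sym (α′ k) (x ⟨ k ⟩) (z ⟨ k ⟩)) ⟩
    (((α′ ⊗ α′) ⊗ Qₚ G (vseq x)) ⊕ (((+ 2) ⊙ α′) ⊗ B)) ⊕ Qₚ G (vseq z)
      ≈⟨ ⊕-cong (⊕-cong (⊗-cong (≋-refl {α′ ⊗ α′}) (Q≋2half x)) (≋-refl {((+ 2) ⊙ α′) ⊗ B}))
                (Q≋2half z) ⟩
    (((α′ ⊗ α′) ⊗ ((+ 2) ⊙ q)) ⊕ (((+ 2) ⊙ α′) ⊗ B)) ⊕ ((+ 2) ⊙ c)
      ≈⟨ ≋-pointwise (λ k → quadratic-doubled (α′ k) (q k) (B k) (c k) (seq w k)) ⟩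
    (+ 2) ⊙ (f ⊕ seq w)
      ≈⟨ ⊙-congˡ (+ 2) f⊕w≋w ⟩
    (+ 2) ⊙ seq w
      ≈⟨ ≈⇒≋ {a} {(+ 2) ⊙ seq w} a≈2w ⟨
    a
      ∎)
    where
    open ≈-Reasoning ≋-setoid
    B q c : Seq
    B = seq (Bₚ x z)
    q = seq (half x)
    c = seq (half z)
    solution : Σ (ℤₚ p) λ α → ∀ k → p^ k ∣ quadratic (q k) (B k) (c k - seq w k) (seq α k)
    solution = hensel (half x) (Bₚ x z) (half z -ₚ w) (Q∈2pℤₚ⇒p∣half₁ x Qx∈2pℤₚ) p∤B₁
    α : ℤₚ p
    α = proj₁ solution
    α′ : Seq
    α′ = seq α
    f : Seq
    f k = quadratic (q k) (B k) (c k - seq w k) (α′ k)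
    f⊕w≋w : f ⊕ seq w ≋ seq w
    f⊕w≋w = ≋-intro λ k → ≡mod-trans (+-≡mod (∣⇒≡mod-0 (proj₂ solution k)) (≡mod-refl {seq w k}))
                                       (≡mod-reflexive (ℤₚ.+-identityˡ (seq w k)))
    y : Lₚ p n
    y i = (α *ₚ x i) +ₚ z i

  Q∈2pℤₚ⇒Λ : ¬ QLₚ≡2ℤₚ p G → ∀ x → Qₚ G (vseq x) ∈ + (2 ℕ.* p) ℤₚ[ p ] → InΛ p G (2 ℕ.* p) x
  Q∈2pℤₚ⇒Λ Q[Lₚ]≢2ℤₚ x Qx∈2pℤₚ z with + p ∣? seq (Bₚ x z) 1
  ... | yes p∣B₁ = p∣B⇒Q[x+z]-Q[z]∈2pℤₚ x z Qx∈2pℤₚ p∣B₁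
  ... | no  p∤B₁ = contradiction Q[Lₚ]≡2ℤₚ Q[Lₚ]≢2ℤₚ
    where
    Q[Lₚ]≡2ℤₚ : QLₚ≡2ℤₚ p G
    Q[Lₚ]≡2ℤₚ a = mk⇔ (QLₚ⊆2ℤₚ (seq a)) (2ℤₚ⊆QLₚ x z Qx∈2pℤₚ p∤B₁ (seq a))

lemma3p2 : (n : ℕ) (G : Gram n) → Symmetric G → PositiveDefinite G →
    Normalized G → (p : ℕ) → Prime p → ¬ QLₚ≡2ℤₚ p G →
    ∀ (x : Lₚ p n) →
      (InΛ p G (2 ℕ.* p) x ⇔ (Qₚ G (vseq x) ∈ + (2 ℕ.* p) ℤₚ[ p ]))
lemma3p2 n G G-sym _ G-normalized p p-prime Q[Lₚ]≢2ℤₚ x =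
  mk⇔ (Λ⇒Q∈mℤₚ {2 ℕ.* p} x) (Q∈2pℤₚ⇒Λ Q[Lₚ]≢2ℤₚ x)
  where
  open LatticeLevels G p
  open NormalizedLattice G G-sym G-normalized p-prime
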